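{- Let $(X,\odot,\ell,r)$ be a local $\ell r$-multisemigroup. Then for all $x,y\in X$: \begin{enumerate} \item $\ell(x\odot y)=\ell(x\odot\ell(y))$ and $r(x\odot y)=r(r(x)\odot y)$; \item $\ell(x\odot y)\odot x=x\odot\ell(y)$ and $y\odot r(x\odot y)=r(x)\odot y$. \end{enumerate}
   Context: A multimagma is a non-empty set $X$ with $\odot:X\times X\to\mathcal{P}X$, extended to subsets by $A\odot B=\bigcup\{a\odot b\mid a\in A,b\in B\}$ (and $x\odot B=\{x\}\odot B$ etc.). $D_{xy}$ means $x\odot y\neq\emptyset$. An $\ell r$-multisemigroup is a multimagma with $\ell,r:X\to X$ such that $x\odot(y\odot z)=(x\odot y)\odot z$ for all $x,y,z$, and $D_{xy}\Rightarrow r(x)=\ell(y)$, $\ell(x)\odot x=\{x\}$, $x\odot r(x)=\{x\}$ for all $x,y$. It is local if $r(x)=\ell(y)\Rightarrow D_{xy}$ for all $x,y$. For $A\subseteq X$, $\ell(A)=\{\ell(a)\mid a\in A\}$, $r(A)=\{r(a)\mid a\in A\}$. -}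

module Defs where

open import Level using (0ℓ)
open import Data.Product using (Σ; ∃; _×_; _,_)
open import Relation.Binary.PropositionalEquality using (_≡_)
open import Relation.Unary using (Pred; _∈_; _≐_; ∅; ｛_｝)
open import Relation.Nullary using (¬_)

-- Extension of a multioperation to subsets: A ⊙ B = ⋃ { a ⊙ b | a ∈ A, b ∈ B }
liftOp : {X : Set} → (X → X → Pred X 0ℓ) → Pred X 0ℓ → Pred X 0ℓ → Pred X 0ℓ
liftOp _⊙_ A B z = Σ _ λ a → Σ _ λ b → a ∈ A × b ∈ B × z ∈ (a ⊙ b)

image : {X : Set} → (X → X) → Pred X 0ℓ → Pred X 0ℓ
image f A z = Σ _ λ a → a ∈ A × z ≡ f a

Defined : {X : Set} → (X → X → Pred X 0ℓ) → X → X → Set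
Defined _⊙_ x y = ∃ λ z → z ∈ (x ⊙ y)

record LRMultisemigroup (X : Set) : Set₁ where
  field
    _⊙_ : X → X → Pred X 0ℓ
    ℓ r : X → X
    nonempty : X
    assoc : ∀ x y z → liftOp _⊙_ ｛ x ｝ (y ⊙ z) ≐ liftOp _⊙_ (x ⊙ y) ｛ z ｝
    D⇒r≡ℓ : ∀ x y → Defined _⊙_ x y → r x ≡ ℓ y
    ℓ-unit : ∀ x → (ℓ x ⊙ x) ≐ ｛ x ｝
    r-unit : ∀ x → (x ⊙ r x) ≐ ｛ x ｝

Local : {X : Set} → LRMultisemigroup X → Set
Local {X} M = ∀ (x y : X) → r x ≡ ℓ y → Defined _⊙_ x y
  where open LRMultisemigroup M

{-# OPTIONS --safe #-}
module Submission where

open import Defs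
open import Level using (0ℓ)
open import Data.Product using (_×_; _,_; proj₁; proj₂; map₁)
open import Relation.Binary.PropositionalEquality using (_≡_; refl; sym; trans; subst)
open import Relation.Unary using (Pred; _∈_; _≐_; ｛_｝)
open import Relation.Unary.Properties using (≐-sym; ≐-trans)

-- Every element of x ⊙ y has left unit ℓ x, so ℓ(x ⊙ y) is {ℓ x} or ∅ according to D_xy,
-- and ℓ(x ⊙ y) ⊙ x is {x} or ∅ likewise.  In a local structure D_xy holds iff r x = ℓ y,
-- which does not change when y is replaced by ℓ y; this gives the ℓ-halves of both parts.
-- The r-halves are the ℓ-halves of the opposite structure.

liftOp-flip : {X : Set} (_⊙_ : X → X → Pred X 0ℓ) (A B : Pred X 0ℓ) →
  liftOp (λ a b → b ⊙ a) A B ≐ liftOp _⊙_ B A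
liftOp-flip _ _ _ =
  (λ (a , b , a∈ , b∈ , z∈) → b , a , b∈ , a∈ , z∈) ,
  (λ (b , a , b∈ , a∈ , z∈) → a , b , a∈ , b∈ , z∈)

opposite : {X : Set} → LRMultisemigroup X → LRMultisemigroup X
opposite M = record
  { _⊙_ = λ a b → b ⊙ a
  ; ℓ = r
  ; r = ℓ
  ; nonempty = nonempty
  ; assoc = λ x y z →
      ≐-trans (liftOp-flip _⊙_ ｛ x ｝ (z ⊙ y))
        (≐-trans (≐-sym (assoc z y x)) (≐-sym (liftOp-flip _⊙_ (y ⊙ x) ｛ z ｝)))
  ; D⇒r≡ℓ = λ x y D → sym (D⇒r≡ℓ y x D)
  ; ℓ-unit = r-unit
  ; r-unit = ℓ-unit
  }
  where open LRMultisemigroup M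

opposite-local : {X : Set} (M : LRMultisemigroup X) → Local M → Local (opposite M)
opposite-local M loc x y e = loc y x (sym e)

module Properties {X : Set} (M : LRMultisemigroup X) where
  open LRMultisemigroup M

  ∈-ℓ⊙ : ∀ x → x ∈ ℓ x ⊙ x
  ∈-ℓ⊙ x = proj₂ (ℓ-unit x) refl

  ∈-⊙r : ∀ x → x ∈ x ⊙ r x
  ∈-⊙r x = proj₂ (r-unit x) refl

  ∈-ℓ⊙⇒≡ : ∀ {x t} → t ∈ ℓ x ⊙ x → t ≡ x
  ∈-ℓ⊙⇒≡ {x} t∈ = sym (proj₁ (ℓ-unit x) t∈)

  ∈-⊙r⇒≡ : ∀ {x t} → t ∈ x ⊙ r x → t ≡ x
  ∈-⊙r⇒≡ {x} t∈ = sym (proj₁ (r-unit x) t∈)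

  r∘ℓ : ∀ x → r (ℓ x) ≡ ℓ x
  r∘ℓ x = D⇒r≡ℓ (ℓ x) x (x , ∈-ℓ⊙ x)

  -- ℓ z ⊙ (x ⊙ y) ∋ z, so by associativity ℓ z ⊙ x is defined.
  ℓ-⊙ : ∀ {x y z} → z ∈ x ⊙ y → ℓ z ≡ ℓ x
  ℓ-⊙ {x} {y} {z} z∈ with proj₁ (assoc (ℓ z) x y) (ℓ z , z , refl , z∈ , ∈-ℓ⊙ z)
  ... | (c , _ , c∈ , _ , _) = trans (sym (r∘ℓ z)) (D⇒r≡ℓ (ℓ z) x (c , c∈))

  ℓ∘ℓ : ∀ x → ℓ (ℓ x) ≡ ℓ x
  ℓ∘ℓ x = sym (ℓ-⊙ (∈-ℓ⊙ x))

  image-ℓ-⊙ : ∀ x y → image ℓ (x ⊙ y) ≐ λ z → Defined _⊙_ x y × z ≡ ℓ x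
  image-ℓ-⊙ x y =
    (λ { (z , z∈ , refl) → (z , z∈) , ℓ-⊙ z∈ }) ,
    (λ { ((z , z∈) , refl) → z , z∈ , sym (ℓ-⊙ z∈) })

  ⊙-ℓ : ∀ x y → x ⊙ ℓ y ≐ λ t → r x ≡ ℓ y × t ≡ x
  ⊙-ℓ x y = to , from
    where
    to : ∀ {t} → t ∈ x ⊙ ℓ y → r x ≡ ℓ y × t ≡ x
    to {t} t∈ = rx≡ℓy , ∈-⊙r⇒≡ (subst (λ w → t ∈ x ⊙ w) (sym rx≡ℓy) t∈)
      where
      rx≡ℓy : r x ≡ ℓ y
      rx≡ℓy = trans (D⇒r≡ℓ x (ℓ y) (t , t∈)) (ℓ∘ℓ y)
    from : ∀ {t} → r x ≡ ℓ y × t ≡ x → t ∈ x ⊙ ℓ y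
    from (rx≡ℓy , refl) = subst (λ w → x ∈ x ⊙ w) rx≡ℓy (∈-⊙r x)

  liftOp-image-ℓ-⊙ : ∀ x y →
    liftOp _⊙_ (image ℓ (x ⊙ y)) ｛ x ｝ ≐ λ t → Defined _⊙_ x y × t ≡ x
  liftOp-image-ℓ-⊙ x y =
    (λ { (_ , _ , (z , z∈ , refl) , refl , t∈) →
      (z , z∈) , ∈-ℓ⊙⇒≡ (subst (λ w → _ ∈ w ⊙ x) (ℓ-⊙ z∈) t∈) }) ,
    (λ { ((z , z∈) , refl) →
      ℓ z , x , (z , z∈ , refl) , refl , subst (λ w → x ∈ w ⊙ x) (sym (ℓ-⊙ z∈)) (∈-ℓ⊙ x) })

module LocalProperties {X : Set} (M : LRMultisemigroup X) (loc : Local M) where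
  open LRMultisemigroup M
  open Properties M

  Defined-ℓʳ : ∀ {x y} → Defined _⊙_ x y → Defined _⊙_ x (ℓ y)
  Defined-ℓʳ {x} {y} D = loc x (ℓ y) (trans (D⇒r≡ℓ x y D) (sym (ℓ∘ℓ y)))

  Defined-ℓʳ⁻¹ : ∀ {x y} → Defined _⊙_ x (ℓ y) → Defined _⊙_ x y
  Defined-ℓʳ⁻¹ {x} {y} D = loc x y (trans (D⇒r≡ℓ x (ℓ y) D) (ℓ∘ℓ y))

  image-ℓ-⊙-ℓ : ∀ x y → image ℓ (x ⊙ y) ≐ image ℓ (x ⊙ ℓ y)
  image-ℓ-⊙-ℓ x y =
    ≐-trans (image-ℓ-⊙ x y)
      (≐-trans (map₁ Defined-ℓʳ , map₁ Defined-ℓʳ⁻¹) (≐-sym (image-ℓ-⊙ x (ℓ y))))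

  liftOp-image-ℓ-⊙-ℓ : ∀ x y → liftOp _⊙_ (image ℓ (x ⊙ y)) ｛ x ｝ ≐ x ⊙ ℓ y
  liftOp-image-ℓ-⊙-ℓ x y =
    ≐-trans (liftOp-image-ℓ-⊙ x y)
      (≐-trans (map₁ (D⇒r≡ℓ x y) , map₁ (loc x y)) (≐-sym (⊙-ℓ x y)))

lemma3p5 : {X : Set} (M : LRMultisemigroup X) → Local M →
    ∀ (x y : X) →
      ((image (LRMultisemigroup.ℓ M) (LRMultisemigroup._⊙_ M x y)
          ≐ image (LRMultisemigroup.ℓ M) (LRMultisemigroup._⊙_ M x (LRMultisemigroup.ℓ M y)))
       × (image (LRMultisemigroup.r M) (LRMultisemigroup._⊙_ M x y)
          ≐ image (LRMultisemigroup.r M) (LRMultisemigroup._⊙_ M (LRMultisemigroup.r M x) y)))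
      × ((liftOp (LRMultisemigroup._⊙_ M) (image (LRMultisemigroup.ℓ M) (LRMultisemigroup._⊙_ M x y)) ｛ x ｝
          ≐ LRMultisemigroup._⊙_ M x (LRMultisemigroup.ℓ M y))
       × (liftOp (LRMultisemigroup._⊙_ M) ｛ y ｝ (image (LRMultisemigroup.r M) (LRMultisemigroup._⊙_ M x y))
          ≐ LRMultisemigroup._⊙_ M (LRMultisemigroup.r M x) y))
lemma3p5 M loc x y =
  (image-ℓ-⊙-ℓ x y , Dual.image-ℓ-⊙-ℓ y x) ,
  (liftOp-image-ℓ-⊙-ℓ x y ,
   ≐-trans (≐-sym (liftOp-flip _⊙_ (image r (x ⊙ y)) ｛ y ｝)) (Dual.liftOp-image-ℓ-⊙-ℓ y x))
  where
  open LRMultisemigroup M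
  open LocalProperties M loc
  module Dual = LocalProperties (opposite M) (opposite-local M loc)
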